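{- $\mathsf{ACC}_{\mathbb{N}}\equiv_{\mathrm{sW}}\mathsf{SEQACC}_{\mathbb{N}}$.
   Context: $\mathsf{ACC}_{\mathbb{N}}$ is the problem: given an enumeration of a set $U\subseteq\mathbb{N}$ with $|U|\le1$, output some element of $\mathbb{N}\setminus U$. The represented space $\omega+1$ has underlying set $\mathbb{N}\cup\{\omega\}$ and representation $\delta:\{0,1\}^\mathbb{N}\to\omega+1$ with $\delta(0^n1p)=n$ for all $p\in\{0,1\}^\mathbb{N}$ and $\delta(0^\omega)=\omega$. Let $\langle\cdot,\cdot\rangle:\mathbb{N}^2\to\mathbb{N}$ be a computable pairing bijection. $\mathsf{SEQACC}_{\mathbb{N}}:\omega+1\rightrightarrows\mathbb{N}$ is defined by $\mathsf{SEQACC}_{\mathbb{N}}(\langle n,m\rangle)=\mathbb{N}\setminus\{n\}$ and $\mathsf{SEQACC}_{\mathbb{N}}(\omega)=\mathbb{N}$. Strong Weihrauch reducibility $f\leq_{\mathrm{sW}}g$: there are computable $H,K$ such that $K\circ G\circ H$ realizes $f$ for every realizer $G$ of $g$; $\equiv_{\mathrm{sW}}$ means reducibility in both directions. -}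

module Defs where

open import Level using (Level; _⊔_) renaming (suc to lsuc; zero to lzero)
open import Data.Nat using (ℕ; zero; suc; _<_; _≤_)
open import Data.Fin using (Fin)
open import Data.Vec using (Vec; []; _∷_; lookup)
open import Data.Product using (Σ; ∃; _×_; _,_; proj₁; proj₂)
open import Data.Unit using (⊤)
open import Relation.Binary.PropositionalEquality using (_≡_; _≢_)
open import Relation.Nullary using (¬_)

Baire : Set
Baire = ℕ → ℕ

-- Oracle partial recursive (μ-recursive) terms of arity n, with one
-- oracle p : Baire.  These give Kleene's notion of computable partial
-- functionals, i.e. type-2 computability on Baire space.

data PR : ℕ → Set where
  zeroF   : ∀ {n} → PR n
  succF   : PR 1
  projF   : ∀ {n} → Fin n → PR n
  compF   : ∀ {n m} → PR m → Vec (PR n) m → PR n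
  primrecF : ∀ {n} → PR n → PR (suc (suc n)) → PR (suc n)
  muF     : ∀ {n} → PR (suc n) → PR n
  oracleF : PR 1

mutual
  data Eval (p : Baire) : ∀ {n} → PR n → Vec ℕ n → ℕ → Set where
    ev-zero : ∀ {n} {xs : Vec ℕ n} → Eval p zeroF xs 0
    ev-succ : ∀ {x} → Eval p succF (x ∷ []) (suc x)
    ev-proj : ∀ {n} {i : Fin n} {xs} → Eval p (projF i) xs (lookup xs i)
    ev-comp : ∀ {n m} {f : PR m} {gs : Vec (PR n) m} {xs ys y} →
              EvalAll p xs gs ys → Eval p f ys y → Eval p (compF f gs) xs y
    ev-rec0 : ∀ {n} {f : PR n} {g} {xs y} →
              Eval p f xs y → Eval p (primrecF f g) (0 ∷ xs) y
    ev-recS : ∀ {n} {f : PR n} {g} {k xs z y} →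
              Eval p (primrecF f g) (k ∷ xs) z →
              Eval p g (k ∷ z ∷ xs) y →
              Eval p (primrecF f g) (suc k ∷ xs) y
    ev-mu   : ∀ {n} {f : PR (suc n)} {xs y} →
              Eval p f (y ∷ xs) 0 →
              (∀ z → z < y → Σ ℕ λ k → Eval p f (z ∷ xs) (suc k)) →
              Eval p (muF f) xs y
    ev-oracle : ∀ {x} → Eval p oracleF (x ∷ []) (p x)

  data EvalAll (p : Baire) {n : ℕ} (xs : Vec ℕ n) :
               ∀ {m} → Vec (PR n) m → Vec ℕ m → Set where
    []  : EvalAll p xs [] []
    _∷_ : ∀ {m g y} {gs : Vec (PR n) m} {ys} →
          Eval p g xs y → EvalAll p xs gs ys → EvalAll p xs (g ∷ gs) (y ∷ ys)

Computes : PR 1 → Baire → Baire → Set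
Computes e p q = ∀ n → Eval p e (n ∷ []) (q n)

-- Multi-valued problems on represented spaces (representations as
-- naming relations  p "names" x ; realizers as functions on Baire space)

record Problem : Set₂ where
  field
    In      : Set₁
    Out     : Set₁
    InName  : Baire → In → Set₁
    OutName : Baire → Out → Set₁
    Dom     : In → Set₁
    Sol     : In → Out → Set₁
open Problem public

Realizer : Problem → (Baire → Baire) → Set₁
Realizer f G = ∀ p x → InName f p x → Dom f x →
               Σ (Out f) λ y → OutName f (G p) y × Sol f x y

_≤sW_ : Problem → Problem → Set₁
f ≤sW g = Σ (PR 1) λ eH → Σ (PR 1) λ eK →
  (G : Baire → Baire) → Realizer g G →
  ∀ p x → InName f p x → Dom f x →
    Σ Baire λ q → Computes eH p q ×
    Σ Baire λ r → Computes eK (G q) r ×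
    Σ (Out f) λ y → OutName f r y × Sol f x y

_≡sW_ : Problem → Problem → Set₁
f ≡sW g = (f ≤sW g) × (g ≤sW f)

record Lift₁ (A : Set) : Set₁ where
  constructor lift
  field lower : A
open Lift₁ public

NameNat : Baire → Lift₁ ℕ → Set₁
NameNat p n = Lift₁ (p 0 ≡ lower n)

-- A computable pairing bijection ⟨_,_⟩ : ℕ² → ℕ (Cantor's diagonal
-- enumeration), given through its inverse unpair : ℕ → ℕ × ℕ.

unpair : ℕ → ℕ × ℕ
unpair zero = 0 , 0
unpair (suc k) with unpair k
... | a , suc b = suc a , b
... | a , zero  = 0 , suc a

-- Enumeration representation: p names U iff U = { n | ∃k. p k = n+1 }
-- (value 0 = "nothing enumerated at this step", allowing U = ∅).

SetN : Set₁
SetN = ℕ → Set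

EnumName : Baire → SetN → Set₁
EnumName p U = Lift₁ ⊤ × (∀ n → (U n → Σ ℕ λ k → p k ≡ suc n)
                                × ((Σ ℕ λ k → p k ≡ suc n) → U n))

ACCℕ : Problem
ACCℕ = record
  { In      = SetN
  ; Out     = Lift₁ ℕ
  ; InName  = EnumName
  ; OutName = NameNat
  ; Dom     = λ U → Lift₁ ⊤ × (∀ a b → U a → U b → a ≡ b)
  ; Sol     = λ U n → Lift₁ (¬ U (lower n))
  }

data ω+1 : Set where
  fin : ℕ → ω+1
  ω   : ω+1

Binary : Baire → Set
Binary p = ∀ k → p k ≤ 1

Nameω+1 : Baire → ω+1 → Set
Nameω+1 p (fin n) = Binary p × (∀ i → i < n → p i ≡ 0) × p n ≡ 1
Nameω+1 p ω       = Binary p × (∀ k → p k ≡ 0)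

SEQACCSol : ω+1 → ℕ → Set
SEQACCSol (fin k) m = m ≢ proj₁ (unpair k)
SEQACCSol ω       m = ⊤

SEQACCℕ : Problem
SEQACCℕ = record
  { In      = Lift₁ ω+1
  ; Out     = Lift₁ ℕ
  ; InName  = λ p x → Lift₁ (Nameω+1 p (lower x))
  ; OutName = NameNat
  ; Dom     = λ _ → Lift₁ ⊤
  ; Sol     = λ x n → Lift₁ (SEQACCSol (lower x) (lower n))
  }

-- Both reductions translate the input name only and pass the output on
-- unchanged.  An enumeration p of a set U with at most one element becomes
-- the name of ω+1 whose only 1 sits at position ⟨n , m⟩, where m is the first
-- stage at which p enumerates anything and n is the element enumerated then;
-- any answer for ⟨n , m⟩ differs from n, hence lies outside U.  Conversely the
-- name of ⟨n , m⟩ becomes the enumeration listing n once, at the position of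
-- the 1.  Both translations are primitive recursive relative to the name,
-- except that unpairing uses a μ-search for the diagonal containing ⟨n , m⟩.
module Submission where

open import Defs
open import Data.Nat
open import Data.Nat.Properties
open import Data.Fin using (#_)
open import Data.Vec using (Vec; []; _∷_; lookup; head)
open import Data.Product using (Σ; ∃; _×_; _,_; proj₁; proj₂; uncurry)
open import Data.Sum using (inj₁; inj₂; _⊎_; [_,_]′)
open import Data.Unit using (tt)
open import Function using (_∘_)
open import Relation.Binary.PropositionalEquality
open import Relation.Binary.Definitions using (tri<; tri≈; tri>)
open import Relation.Nullary using (¬_; yes; no; contradiction)

private variable
  p : Baire
  c k m n : ℕ

∣m-n∣≡m∸n+n∸m : ∀ m n → ∣ m - n ∣ ≡ m ∸ n + (n ∸ m)
∣m-n∣≡m∸n+n∸m zero    zero    = refl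
∣m-n∣≡m∸n+n∸m zero    (suc n) = refl
∣m-n∣≡m∸n+n∸m (suc m) zero    = sym (+-identityʳ (suc m))
∣m-n∣≡m∸n+n∸m (suc m) (suc n) = ∣m-n∣≡m∸n+n∸m m n

1∸n≢0⇒n≡0 : 1 ∸ n ≢ 0 → n ≡ 0
1∸n≢0⇒n≡0 = n<1⇒n≡0 ∘ m∸n≢0⇒n<m

m*n≢0⇒m≢0×n≢0 : m * n ≢ 0 → m ≢ 0 × n ≢ 0
m*n≢0⇒m≢0×n≢0 {m} {n} m*n≢0 =
    (λ m≡0 → m*n≢0 (cong (_* n) m≡0))
  , (λ n≡0 → m*n≢0 (trans (cong (m *_) n≡0) (*-zeroʳ m)))

triangle : ℕ → ℕ
triangle zero    = 0
triangle (suc n) = suc n + triangle n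

pair : ℕ → ℕ → ℕ
pair a b = triangle (a + b) + a

diagonal : ℕ → ℕ
diagonal = uncurry _+_ ∘ unpair

pair[1+a,b]≡1+pair[a,1+b] : ∀ a b → pair (suc a) b ≡ suc (pair a (suc b))
pair[1+a,b]≡1+pair[a,1+b] a b = begin
  triangle (suc (a + b)) + suc a    ≡⟨ +-suc _ a ⟩
  suc (triangle (suc (a + b)) + a)  ≡⟨ cong (λ s → suc (triangle s + a)) (sym (+-suc a b)) ⟩
  suc (triangle (a + suc b) + a)    ∎
  where open ≡-Reasoning

pair[0,1+a]≡1+pair[a,0] : ∀ a → pair 0 (suc a) ≡ suc (pair a 0)
pair[0,1+a]≡1+pair[a,0] a = begin
  triangle (suc a) + 0        ≡⟨ +-identityʳ _ ⟩
  suc (a + triangle a)        ≡⟨ cong suc (+-comm a _) ⟩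
  suc (triangle a + a)        ≡⟨ cong (λ s → suc (triangle s + a)) (sym (+-identityʳ a)) ⟩
  suc (triangle (a + 0) + a)  ∎
  where open ≡-Reasoning

pair-unpair : ∀ k → uncurry pair (unpair k) ≡ k
pair-unpair zero = refl
pair-unpair (suc k) with unpair k | pair-unpair k
... | a , suc b | eq = trans (pair[1+a,b]≡1+pair[a,1+b] a b) (cong suc eq)
... | a , zero  | eq = trans (pair[0,1+a]≡1+pair[a,0] a) (cong suc eq)

unpair-pair : ∀ a b → unpair (pair a b) ≡ (a , b)
unpair-pair a b = pair≡⇒unpair≡ a b refl
  where
  pair≡⇒unpair≡ : ∀ {k} a b → pair a b ≡ k → unpair k ≡ (a , b)
  pair≡⇒unpair≡ {zero}  zero    zero    _  = refl
  pair≡⇒unpair≡ {suc k} (suc a) b       eq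
    rewrite pair≡⇒unpair≡ a (suc b)
              (suc-injective (trans (sym (pair[1+a,b]≡1+pair[a,1+b] a b)) eq)) = refl
  pair≡⇒unpair≡ {suc k} zero    (suc b) eq
    rewrite pair≡⇒unpair≡ b zero
              (suc-injective (trans (sym (pair[0,1+a]≡1+pair[a,0] b)) eq)) = refl

triangle-mono-≤ : m ≤ n → triangle m ≤ triangle n
triangle-mono-≤ z≤n       = z≤n
triangle-mono-≤ (s≤s m≤n) = +-mono-≤ (s≤s m≤n) (triangle-mono-≤ m≤n)

pair-bounds : ∀ a b → triangle (a + b) ≤ pair a b × pair a b < triangle (suc (a + b))
pair-bounds a b =
    m≤m+n _ a
  , subst (_< triangle (suc (a + b))) (+-comm a _)
      (+-monoˡ-< (triangle (a + b)) (s≤s (m≤m+n a b)))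

diagonal-bounds : ∀ k → triangle (diagonal k) ≤ k × k < triangle (suc (diagonal k))
diagonal-bounds k =
  subst (λ k′ → triangle (diagonal k) ≤ k′ × k′ < triangle (suc (diagonal k)))
    (pair-unpair k) (uncurry pair-bounds (unpair k))

ZeroBelow : Baire → ℕ → Set
ZeroBelow p k = ∀ j → j < k → p j ≡ 0

FirstNonZero : Baire → ℕ → Set
FirstNonZero p m = p m ≢ 0 × ZeroBelow p m

firstNonZero-unique : FirstNonZero p m → FirstNonZero p n → m ≡ n
firstNonZero-unique {m = m} {n = n} (pm≢0 , below-m) (pn≢0 , below-n) with <-cmp m n
... | tri< m<n _ _ = contradiction (below-n m m<n) pm≢0
... | tri≈ _ m≡n _ = m≡n
... | tri> _ _ n<m = contradiction (below-m n n<m) pn≢0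

zeroBelow⊎firstNonZero : ∀ p k → ZeroBelow p k ⊎ ∃ (FirstNonZero p)
zeroBelow⊎firstNonZero p zero = inj₁ λ _ ()
zeroBelow⊎firstNonZero p (suc k) with zeroBelow⊎firstNonZero p k | p k ≟ 0
... | inj₂ first  | _       = inj₂ first
... | inj₁ below  | no pk≢0 = inj₂ (k , pk≢0 , below)
... | inj₁ below  | yes pk≡0 = inj₁ λ j j<1+k →
  [ below j , (λ { refl → pk≡0 }) ]′ (m<1+n⇒m<n∨m≡n j<1+k)

firstNonZero-exists : p k ≢ 0 → ∃ (FirstNonZero p)
firstNonZero-exists {p} {k} pk≢0 with zeroBelow⊎firstNonZero p (suc k)
... | inj₁ below = contradiction (below k (n<1+n k)) pk≢0
... | inj₂ first = first

partialSum : Baire → ℕ → ℕ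
partialSum p zero    = 0
partialSum p (suc k) = p k + partialSum p k

partialSum≡0⇒zeroBelow : partialSum p k ≡ 0 → ZeroBelow p k
partialSum≡0⇒zeroBelow {p} {suc k} sum≡0 j j<1+k with m<1+n⇒m<n∨m≡n j<1+k
... | inj₁ j<k  = partialSum≡0⇒zeroBelow (m+n≡0⇒n≡0 (p k) sum≡0) j j<k
... | inj₂ refl = m+n≡0⇒m≡0 (p k) sum≡0

zeroBelow⇒partialSum≡0 : ZeroBelow p k → partialSum p k ≡ 0
zeroBelow⇒partialSum≡0 {k = zero}  _     = refl
zeroBelow⇒partialSum≡0 {k = suc k} below =
  cong₂ _+_ (below k (n<1+n k)) (zeroBelow⇒partialSum≡0 (λ j j<k → below j (m<n⇒m<1+n j<k)))

Denotes : Baire → PR n → (Vec ℕ n → ℕ) → Set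
Denotes p e f = ∀ xs → Eval p e xs (f xs)

Computes₂ : PR 2 → Baire → (ℕ → ℕ → ℕ) → Set
Computes₂ e p f = ∀ x y → Eval p e (x ∷ y ∷ []) (f x y)

infixr 9 _·_

_·_ : PR 1 → PR n → PR n
g · e = compF g (e ∷ [])

_⟨_,_⟩ : PR 2 → PR n → PR n → PR n
g ⟨ e₁ , e₂ ⟩ = compF g (e₁ ∷ e₂ ∷ [])

zero-denotes : Denotes p (zeroF {n}) (λ _ → 0)
zero-denotes _ = ev-zero

proj-denotes : ∀ i → Denotes p (projF {n} i) (λ xs → lookup xs i)
proj-denotes _ _ = ev-proj

succ-computes : Computes succF p suc
succ-computes _ = ev-succ

oracle-computes : Computes oracleF p p
oracle-computes _ = ev-oracle

computes⇒denotes : ∀ {e f} → Computes e p f → Denotes p e (f ∘ head)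
computes⇒denotes r (x ∷ []) = r x

denotes⇒computes : ∀ {e f} → Denotes p e f → Computes e p (λ x → f (x ∷ []))
denotes⇒computes r x = r (x ∷ [])

computes-≗ : ∀ {e f g} → Computes e p f → f ≗ g → Computes e p g
computes-≗ {p = p} {e} r f≗g x = subst (Eval p e (x ∷ [])) (f≗g x) (r x)

·-denotes : ∀ {g G} {e : PR n} {f} → Computes g p G → Denotes p e f → Denotes p (g · e) (G ∘ f)
·-denotes rg re xs = ev-comp (re xs ∷ []) (rg _)

⟨,⟩-denotes : ∀ {g G} {e₁ e₂ : PR n} {f₁ f₂} → Computes₂ g p G →
              Denotes p e₁ f₁ → Denotes p e₂ f₂ →
              Denotes p (g ⟨ e₁ , e₂ ⟩) (λ xs → G (f₁ xs) (f₂ xs))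
⟨,⟩-denotes rg r₁ r₂ xs = ev-comp (r₁ xs ∷ r₂ xs ∷ []) (rg _ _)

primrec-evaluates : ∀ {f : PR n} {g F G} → Denotes p f F → Denotes p g G →
                    (h : ℕ → Vec ℕ n → ℕ) →
                    (∀ xs → h 0 xs ≡ F xs) →
                    (∀ k xs → h (suc k) xs ≡ G (k ∷ h k xs ∷ xs)) →
                    ∀ k xs → Eval p (primrecF f g) (k ∷ xs) (h k xs)
primrec-evaluates {p = p} rf rg h h-zero h-suc zero xs =
  subst (Eval p _ _) (sym (h-zero xs)) (ev-rec0 (rf xs))
primrec-evaluates {p = p} rf rg h h-zero h-suc (suc k) xs =
  subst (Eval p _ _) (sym (h-suc k xs))
    (ev-recS (primrec-evaluates rf rg h h-zero h-suc k xs) (rg _))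

primrec-computes : ∀ {f : PR 0} {g F G} → Denotes p f F → Denotes p g G →
                   (h : ℕ → ℕ) → h 0 ≡ F [] → (∀ k → h (suc k) ≡ G (k ∷ h k ∷ [])) →
                   Computes (primrecF f g) p h
primrec-computes rf rg h h-zero h-suc k =
  primrec-evaluates rf rg (λ k _ → h k) (λ { [] → h-zero }) (λ { k [] → h-suc k }) k []

primrec-computes₂ : ∀ {f : PR 1} {g F G} → Denotes p f F → Denotes p g G →
                    (h : ℕ → ℕ → ℕ) → (∀ x → h 0 x ≡ F (x ∷ [])) →
                    (∀ k x → h (suc k) x ≡ G (k ∷ h k x ∷ x ∷ [])) →
                    Computes₂ (primrecF f g) p h
primrec-computes₂ rf rg h h-zero h-suc k x =
  primrec-evaluates rf rg (λ { k (x ∷ []) → h k x })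
    (λ { (x ∷ []) → h-zero x }) (λ { k (x ∷ []) → h-suc k x }) k (x ∷ [])

μ-evaluates : ∀ {f : PR (suc n)} {F xs y} → Denotes p f F →
              F (y ∷ xs) ≡ 0 → (∀ z → z < y → F (z ∷ xs) ≢ 0) →
              Eval p (muF f) xs y
μ-evaluates {p = p} {f = f} {F} {xs} rf at-y≡0 below-y≢0 =
  ev-mu (subst (Eval p f _) at-y≡0 (rf _)) λ z z<y → positive (rf (z ∷ xs)) (below-y≢0 z z<y)
  where
  positive : ∀ {z v} → Eval p f (z ∷ xs) v → v ≢ 0 → Σ ℕ λ v′ → Eval p f (z ∷ xs) (suc v′)
  positive {v = zero}  _  v≢0 = contradiction refl v≢0
  positive {v = suc v} ev _   = v , ev

predᵀ : PR 1
predᵀ = primrecF zeroF (projF (# 0))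

pred-computes : Computes predᵀ p pred
pred-computes = primrec-computes zero-denotes (proj-denotes (# 0)) pred refl (λ _ → refl)

-- Primitive recursion runs on the first argument, so monusᵀ ⟨ k , x ⟩ is x ∸ k.
monusᵀ : PR 2
monusᵀ = primrecF (projF (# 0)) (predᵀ · projF (# 1))

monus-computes : Computes₂ monusᵀ p (λ k x → x ∸ k)
monus-computes = primrec-computes₂ (proj-denotes (# 0))
  (·-denotes pred-computes (proj-denotes (# 1)))
  (λ k x → x ∸ k) (λ _ → refl) (λ k x → sym (pred[m∸n]≡m∸[1+n] x k))

addᵀ : PR 2
addᵀ = primrecF (projF (# 0)) (succF · projF (# 1))

add-computes : Computes₂ addᵀ p _+_
add-computes = primrec-computes₂ (proj-denotes (# 0))
  (·-denotes succ-computes (proj-denotes (# 1))) _+_ (λ _ → refl) (λ _ _ → refl)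

infixl 6 _+ᵀ_ _∸ᵀ_

_+ᵀ_ _∸ᵀ_ : PR n → PR n → PR n
e₁ +ᵀ e₂ = addᵀ ⟨ e₁ , e₂ ⟩
e₁ ∸ᵀ e₂ = monusᵀ ⟨ e₂ , e₁ ⟩

+ᵀ-denotes : ∀ {e₁ e₂ : PR n} {f₁ f₂} → Denotes p e₁ f₁ → Denotes p e₂ f₂ →
             Denotes p (e₁ +ᵀ e₂) (λ xs → f₁ xs + f₂ xs)
+ᵀ-denotes = ⟨,⟩-denotes add-computes

∸ᵀ-denotes : ∀ {e₁ e₂ : PR n} {f₁ f₂} → Denotes p e₁ f₁ → Denotes p e₂ f₂ →
             Denotes p (e₁ ∸ᵀ e₂) (λ xs → f₁ xs ∸ f₂ xs)
∸ᵀ-denotes r₁ r₂ = ⟨,⟩-denotes monus-computes r₂ r₁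

mulᵀ : PR 2
mulᵀ = primrecF zeroF (projF (# 2) +ᵀ projF (# 1))

mul-computes : Computes₂ mulᵀ p _*_
mul-computes = primrec-computes₂ zero-denotes
  (+ᵀ-denotes (proj-denotes (# 2)) (proj-denotes (# 1))) _*_ (λ _ → refl) (λ _ _ → refl)

infixl 7 _*ᵀ_

_*ᵀ_ : PR n → PR n → PR n
e₁ *ᵀ e₂ = mulᵀ ⟨ e₁ , e₂ ⟩

*ᵀ-denotes : ∀ {e₁ e₂ : PR n} {f₁ f₂} → Denotes p e₁ f₁ → Denotes p e₂ f₂ →
             Denotes p (e₁ *ᵀ e₂) (λ xs → f₁ xs * f₂ xs)
*ᵀ-denotes = ⟨,⟩-denotes mul-computes

oneᵀ : PR n
oneᵀ = succF · zeroF

one-denotes : Denotes p (oneᵀ {n}) (λ _ → 1)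
one-denotes = ·-denotes succ-computes zero-denotes

distᵀ : PR n → PR n → PR n
distᵀ e₁ e₂ = (e₁ ∸ᵀ e₂) +ᵀ (e₂ ∸ᵀ e₁)

dist-denotes : ∀ {e₁ e₂ : PR n} {f₁ f₂} → Denotes p e₁ f₁ → Denotes p e₂ f₂ →
               Denotes p (distᵀ e₁ e₂) (λ xs → ∣ f₁ xs - f₂ xs ∣)
dist-denotes {p = p} {f₁ = f₁} {f₂} r₁ r₂ xs = subst (Eval p _ xs) (sym (∣m-n∣≡m∸n+n∸m (f₁ xs) (f₂ xs)))
  (+ᵀ-denotes (∸ᵀ-denotes r₁ r₂) (∸ᵀ-denotes r₂ r₁) xs)

triangleᵀ : PR 1
triangleᵀ = primrecF zeroF (succF · projF (# 0) +ᵀ projF (# 1))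

triangle-computes : Computes triangleᵀ p triangle
triangle-computes = primrec-computes zero-denotes
  (+ᵀ-denotes (·-denotes succ-computes (proj-denotes (# 0))) (proj-denotes (# 1)))
  triangle refl (λ _ → refl)

partialSumᵀ : PR 1
partialSumᵀ = primrecF zeroF (oracleF · projF (# 0) +ᵀ projF (# 1))

partialSum-computes : Computes partialSumᵀ p (partialSum p)
partialSum-computes {p} = primrec-computes zero-denotes
  (+ᵀ-denotes (·-denotes oracle-computes (proj-denotes (# 0))) (proj-denotes (# 1)))
  (partialSum p) refl (λ _ → refl)

-- The least s with k < triangle (suc s).
diagonalᵀ : PR 1
diagonalᵀ = muF (succF · projF (# 1) ∸ᵀ triangleᵀ · succF · projF (# 0))

diagonal-computes : Computes diagonalᵀ p diagonal
diagonal-computes k = μ-evaluates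
  (∸ᵀ-denotes (·-denotes succ-computes (proj-denotes (# 1)))
              (·-denotes triangle-computes (·-denotes succ-computes (proj-denotes (# 0)))))
  (m≤n⇒m∸n≡0 (proj₂ (diagonal-bounds k)))
  (λ z z<s → m>n⇒m∸n≢0 (s≤s (≤-trans (triangle-mono-≤ z<s) (proj₁ (diagonal-bounds k)))))

fstᵀ : PR 1
fstᵀ = projF (# 0) ∸ᵀ triangleᵀ · diagonalᵀ

fst-computes : Computes fstᵀ p (proj₁ ∘ unpair)
fst-computes = computes-≗
  (denotes⇒computes (∸ᵀ-denotes (proj-denotes (# 0))
                                (·-denotes triangle-computes (computes⇒denotes diagonal-computes))))
  λ k → trans (cong (_∸ triangle (diagonal k)) (sym (pair-unpair k)))
              (m+n∸m≡n (triangle (diagonal k)) (proj₁ (unpair k)))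

sndᵀ : PR 1
sndᵀ = diagonalᵀ ∸ᵀ fstᵀ

snd-computes : Computes sndᵀ p (proj₂ ∘ unpair)
snd-computes = computes-≗
  (denotes⇒computes (∸ᵀ-denotes (computes⇒denotes diagonal-computes)
                                (computes⇒denotes fst-computes)))
  λ k → m+n∸m≡n (proj₁ (unpair k)) _

≤sW-by-input-translation : ∀ f g {eH : PR 1} {T : Baire → Baire} →
                           (∀ p → Computes eH p (T p)) →
                           (∀ G → Realizer g G → Realizer f (G ∘ T)) → f ≤sW g
≤sW-by-input-translation f g {eH} {T} eH-computes reduces =
  eH , oracleF , λ G G-realizes p x p-names x∈dom →
    T p , eH-computes p , G (T p) , oracle-computes , reduces G G-realizes p x p-names x∈dom

-- From enumerations to names of ω+1

isFirstEnumeration : Baire → ℕ → ℕ → ℕ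
isFirstEnumeration p n m = 1 ∸ (∣ p m - suc n ∣ + partialSum p m)

isFirstEnumeration≤1 : isFirstEnumeration p n m ≤ 1
isFirstEnumeration≤1 {p} {n} {m} = m∸n≤m 1 (∣ p m - suc n ∣ + partialSum p m)

isFirstEnumeration≢0 : isFirstEnumeration p n m ≢ 0 → p m ≡ suc n × ZeroBelow p m
isFirstEnumeration≢0 {p} {n} {m} indicator≢0 =
    ∣m-n∣≡0⇒m≡n (m+n≡0⇒m≡0 _ sum≡0)
  , partialSum≡0⇒zeroBelow (m+n≡0⇒n≡0 ∣ p m - suc n ∣ sum≡0)
  where
  sum≡0 : ∣ p m - suc n ∣ + partialSum p m ≡ 0
  sum≡0 = 1∸n≢0⇒n≡0 indicator≢0

isFirstEnumeration≡1 : p m ≡ suc n → ZeroBelow p m → isFirstEnumeration p n m ≡ 1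
isFirstEnumeration≡1 {p} {m} {n} pm≡1+n below =
  cong₂ (λ d s → 1 ∸ (d + s))
    (trans (cong ∣_- suc n ∣ pm≡1+n) (∣n-n∣≡0 (suc n)))
    (zeroBelow⇒partialSum≡0 below)

enum→ω+1 : Baire → Baire
enum→ω+1 p = uncurry (isFirstEnumeration p) ∘ unpair

enum→ω+1ᵀ : PR 1
enum→ω+1ᵀ = oneᵀ ∸ᵀ (distᵀ (oracleF · sndᵀ) (succF · fstᵀ) +ᵀ partialSumᵀ · sndᵀ)

enum→ω+1-computes : Computes enum→ω+1ᵀ p (enum→ω+1 p)
enum→ω+1-computes = denotes⇒computes
  (∸ᵀ-denotes one-denotes
    (+ᵀ-denotes (dist-denotes (·-denotes oracle-computes snd-denotes)
                              (·-denotes succ-computes fst-denotes))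
                (·-denotes partialSum-computes snd-denotes)))
  where
  fst-denotes : Denotes p fstᵀ (proj₁ ∘ unpair ∘ head)
  fst-denotes = computes⇒denotes fst-computes
  snd-denotes : Denotes p sndᵀ (proj₂ ∘ unpair ∘ head)
  snd-denotes = computes⇒denotes snd-computes

enum→ω+1-names : p m ≡ suc n → ZeroBelow p m → Nameω+1 (enum→ω+1 p) (fin (pair n m))
enum→ω+1-names {p} {m} {n} pm≡1+n below =
  (λ i → isFirstEnumeration≤1 {p} {proj₁ (unpair i)} {proj₂ (unpair i)}) , zero-before , at-code
  where
  q : Baire
  q = enum→ω+1 p

  only-code : ∀ i → q i ≢ 0 → i ≡ pair n m
  only-code i qi≢0 = trans (sym (pair-unpair i)) (cong₂ pair a≡n b≡m)
    where
    first : p (proj₂ (unpair i)) ≡ suc (proj₁ (unpair i)) × ZeroBelow p (proj₂ (unpair i))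
    first = isFirstEnumeration≢0 qi≢0
    b≡m : proj₂ (unpair i) ≡ m
    b≡m = firstNonZero-unique (subst (_≢ 0) (sym (proj₁ first)) 1+n≢0 , proj₂ first)
                              (subst (_≢ 0) (sym pm≡1+n) 1+n≢0 , below)
    a≡n : proj₁ (unpair i) ≡ n
    a≡n = suc-injective (trans (sym (proj₁ first)) (trans (cong p b≡m) pm≡1+n))

  zero-before : ∀ i → i < pair n m → q i ≡ 0
  zero-before i i<code with q i ≟ 0
  ... | yes qi≡0 = qi≡0
  ... | no  qi≢0 = contradiction (only-code i qi≢0) (<⇒≢ i<code)

  at-code : q (pair n m) ≡ 1
  at-code = trans (cong (uncurry (isFirstEnumeration p)) (unpair-pair n m))
                  (isFirstEnumeration≡1 pm≡1+n below)

-- Whether p enumerates anything is undecidable, so the first enumeration is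
-- located only after assuming that the answer lies in U.
enum→ω+1-reduces : ∀ G → Realizer SEQACCℕ G → Realizer ACCℕ (G ∘ enum→ω+1)
enum→ω+1-reduces G G-realizes p U (_ , enumerates) (_ , unique) =
  lift (G (enum→ω+1 p) 0) , lift refl , lift avoids
  where
  answer-differs : p m ≡ suc n → ZeroBelow p m → G (enum→ω+1 p) 0 ≢ n
  answer-differs {m} {n} pm≡1+n below
    with G-realizes (enum→ω+1 p) (lift (fin (pair n m)))
                    (lift (enum→ω+1-names pm≡1+n below)) (lift tt)
  ... | y , lift answer≡y , lift y≢code = λ answer≡n →
    subst (lower y ≢_) (cong proj₁ (unpair-pair n m)) y≢code (trans (sym answer≡y) answer≡n)

  avoids : ¬ U (G (enum→ω+1 p) 0)
  avoids u with proj₁ (enumerates _) u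
  ... | k , pk≡1+answer with firstNonZero-exists {p} {k} (subst (_≢ 0) (sym pk≡1+answer) 1+n≢0)
  ...   | m , pm≢0 , below =
    answer-differs pm≡1+n below (unique _ _ u (proj₂ (enumerates _) (m , pm≡1+n)))
    where
    pm≡1+n : p m ≡ suc (pred (p m))
    pm≡1+n = sym (suc-pred (p m) {{≢-nonZero pm≢0}})

-- From names of ω+1 to enumerations

ω+1→enum : Baire → Baire
ω+1→enum p k = p k * (1 ∸ partialSum p k) * suc (proj₁ (unpair k))

ω+1→enumᵀ : PR 1
ω+1→enumᵀ = oracleF *ᵀ (oneᵀ ∸ᵀ partialSumᵀ) *ᵀ succF · fstᵀ

ω+1→enum-computes : Computes ω+1→enumᵀ p (ω+1→enum p)
ω+1→enum-computes = denotes⇒computes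
  (*ᵀ-denotes (*ᵀ-denotes (computes⇒denotes oracle-computes)
                          (∸ᵀ-denotes one-denotes (computes⇒denotes partialSum-computes)))
              (·-denotes succ-computes (computes⇒denotes fst-computes)))

ω+1→enum≢0 : ω+1→enum p k ≢ 0 → FirstNonZero p k
ω+1→enum≢0 {p} {k} qk≢0 =
  let (pk*ok≢0 , _) = m*n≢0⇒m≢0×n≢0 qk≢0
      (pk≢0 , ok≢0) = m*n≢0⇒m≢0×n≢0 pk*ok≢0
  in pk≢0 , partialSum≡0⇒zeroBelow (1∸n≢0⇒n≡0 ok≢0)

ω+1→enum-at : p c ≡ 1 → ZeroBelow p c → ω+1→enum p c ≡ suc (proj₁ (unpair c))
ω+1→enum-at {p} {c} pc≡1 below
  rewrite pc≡1 | zeroBelow⇒partialSum≡0 below = *-identityˡ _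

ω+1→enum-enumerates : Nameω+1 p (fin c) → EnumName (ω+1→enum p) (_≡ proj₁ (unpair c))
ω+1→enum-enumerates {p} {c} (_ , below , pc≡1) = lift tt , λ n →
  (λ { refl → c , at-c }) , λ (k , qk≡1+n) →
    let k≡c = firstNonZero-unique (ω+1→enum≢0 (subst (_≢ 0) (sym qk≡1+n) 1+n≢0))
                                  (subst (_≢ 0) (sym pc≡1) 1+n≢0 , below)
    in suc-injective (trans (sym qk≡1+n) (trans (cong (ω+1→enum p) k≡c) at-c))
  where
  at-c : ω+1→enum p c ≡ suc (proj₁ (unpair c))
  at-c = ω+1→enum-at pc≡1 below

ω+1→enum-reduces : ∀ G → Realizer ACCℕ G → Realizer SEQACCℕ (G ∘ ω+1→enum)
ω+1→enum-reduces _ G-realizes p (lift (fin c)) (lift p-names) _ =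
  G-realizes (ω+1→enum p) (_≡ proj₁ (unpair c)) (ω+1→enum-enumerates p-names)
             (lift tt , λ _ _ a≡ b≡ → trans a≡ (sym b≡))
ω+1→enum-reduces G _ p (lift ω) _ _ = lift (G (ω+1→enum p) 0) , lift refl , lift tt

lemma11 : ACCℕ ≡sW SEQACCℕ
lemma11 = ≤sW-by-input-translation ACCℕ SEQACCℕ (λ _ → enum→ω+1-computes) enum→ω+1-reduces
        , ≤sW-by-input-translation SEQACCℕ ACCℕ (λ _ → ω+1→enum-computes) ω+1→enum-reduces
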